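{- In the setting described in the context, every vertex $x\in X$ that is adjacent in $G$ to some vertex $y\in V(A)$, where $A\in\mathcal{A}$, is also adjacent in $G$ to the vertex $z(A)$.
   Context: Let $G$ be a finite simple undirected graph; a chordless cycle is an induced cycle on at least four vertices, and a graph is chordal if it has none. Let $E_I,E_M\subseteq E(G)$ and for $u\in V(G)$ let $N^R_G(u)=\{w\in N_G(u):\{u,w\}\notin E_I\cup E_M\}$. Fix $v\in V(G)$ and a set $B_v\subseteq V(G)\setminus\{v\}$ such that $G\setminus B_v$ is chordal. Let $I$ be an independent set of $G$ with $I\subseteq N^R_G(v)\setminus B_v$. Let $X=N_G(v)\setminus(B_v\cup I)$, let $H=G\setminus(\{v\}\cup B_v\cup X)$, and let $\mathcal{A}$ be the set of connected components of $H$ that contain at least one vertex of $I$. Each $A\in\mathcal{A}$ contains exactly one vertex of $I$ (and no other neighbor of $v$); this vertex is denoted $z(A)$. -}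

module Defs where

open import Data.Nat using (ℕ; zero; suc; _+_; _%_)
open import Data.Fin using (Fin; toℕ)
open import Data.Fin.Subset using (Subset; _∈_; _∉_)
open import Data.Bool using (Bool; T)
open import Data.Product using (Σ; _×_)
open import Data.Sum using (_⊎_)
open import Relation.Nullary using (¬_)
open import Relation.Binary.PropositionalEquality using (_≡_; _≢_)
open import Function.Definitions using (Injective)
open import Function.Bundles using (_⇔_)

record Graph (n : ℕ) : Set where
  field
    adj     : Fin n → Fin n → Bool
    symm    : ∀ u w → adj u w ≡ adj w u
    irrefl  : ∀ u → ¬ T (adj u u)

open Graph public

Adj : ∀ {n} → Graph n → Fin n → Fin n → Set
Adj G u w = T (adj G u w)

VSet : ℕ → Set₁
VSet n = Fin n → Set

CycAdj : (m : ℕ) → Fin (4 + m) → Fin (4 + m) → Set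
CycAdj m i j = (suc (toℕ i) % (4 + m) ≡ toℕ j) ⊎ (suc (toℕ j) % (4 + m) ≡ toℕ i)

ChordlessCycleIn : ∀ {n} → Graph n → VSet n → Set
ChordlessCycleIn {n} G W =
  Σ ℕ λ m → Σ (Fin (4 + m) → Fin n) λ c →
    Injective _≡_ _≡_ c × (∀ i → W (c i)) × (∀ i j → Adj G (c i) (c j) ⇔ CycAdj m i j)

ChordalOn : ∀ {n} → Graph n → VSet n → Set
ChordalOn G W = ¬ ChordlessCycleIn G W

Minus : ∀ {n} → Subset n → VSet n
Minus S u = u ∉ S

EdgeIn : ∀ {n} → (Fin n → Fin n → Set) → Fin n → Fin n → Set
EdgeIn E u w = E u w ⊎ E w u

EdgeSubset : ∀ {n} → Graph n → (Fin n → Fin n → Set) → Set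
EdgeSubset G E = ∀ u w → E u w → Adj G u w

InNR : ∀ {n} → Graph n → (EI EM : Fin n → Fin n → Set) → Fin n → Fin n → Set
InNR G EI EM u w = Adj G u w × ¬ EdgeIn EI u w × ¬ EdgeIn EM u w

IndependentSet : ∀ {n} → Graph n → Subset n → Set
IndependentSet G I = ∀ u w → u ∈ I → w ∈ I → ¬ Adj G u w

XSet : ∀ {n} → Graph n → Fin n → Subset n → Subset n → VSet n
XSet G v Bv I u = Adj G v u × u ∉ Bv × u ∉ I

HSet : ∀ {n} → Graph n → Fin n → Subset n → Subset n → VSet n
HSet G v Bv I u = u ≢ v × u ∉ Bv × ¬ XSet G v Bv I u

data Connected {n} (G : Graph n) (W : VSet n) : Fin n → Fin n → Set where
  here : ∀ {u} → W u → Connected G W u u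
  step : ∀ {u w t} → W u → Adj G u w → Connected G W w t → Connected G W u t

ComponentOf : ∀ {n} → Graph n → VSet n → Fin n → VSet n
ComponentOf G W z y = Connected G W z y

-- Suppose x ∈ X is adjacent to y ∈ V(A) but not to z = z(A). Follow an induced path of H
-- from z towards y and stop at its first vertex t that is a neighbour of x or lies in I ∖ {z}.
-- Its other vertices are not adjacent to x and, apart from z, lie outside I; as N(v) ∩ V(H) ⊆ I,
-- no vertex of the path other than z and t is adjacent to v.
-- If t ∈ I, then v closes the path into a chordless cycle, as z and t are non-adjacent; if
-- t ∉ I, then x ∼ t and x closes the path v z … t. Either cycle avoids B_v, contradicting the
-- chordality of G ∖ B_v.

module Submission where

open import Defs
open import Data.Bool using (T)
open import Data.Nat using (ℕ; suc; _+_; _%_; _<_)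
open import Data.Nat.Properties using (m≤n⇒m<n∨m≡n; suc-injective; <-irrefl)
open import Data.Nat.DivMod using (m<n⇒m%n≡m; n%n≡0)
open import Data.Fin using (Fin; toℕ; zero; suc)
open import Data.Fin.Properties using (toℕ<n; toℕ-injective; _≟_)
open import Data.Fin.Subset using (Subset; _∈_; _∉_)
open import Data.Fin.Subset.Properties using (_∈?_)
open import Data.Product using (Σ-syntax; _×_; _,_; proj₁; proj₂)
open import Data.Sum using (_⊎_; inj₁; inj₂; swap; [_,_])
open import Data.Sum.Function.Propositional using (_⊎-⇔_)
open import Data.Empty using (⊥-elim)
open import Data.List using (List; []; _∷_; length; lookup)
open import Data.List.Relation.Unary.All as All using (All; []; _∷_)
open import Data.List.Relation.Unary.All.Properties using (anti-mono; ¬Any⇒All¬)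
open import Data.List.Relation.Unary.Any using (Any; here; there; any?)
open import Data.List.Membership.Propositional using () renaming (_∈_ to _∈ₗ_)
open import Data.List.Membership.Propositional.Properties using (∈-lookup)
open import Data.List.Relation.Binary.Subset.Propositional using (_⊆_)
open import Function using (_∘_; id)
open import Function.Bundles using (_⇔_; mk⇔)
import Function.Properties.Equivalence as ⇔
open import Function.Definitions using (Injective)
open import Relation.Nullary using (¬_; Dec; yes; no)
open import Relation.Nullary.Decidable using (T?; decidable-stable; ¬?; _×-dec_; _⊎-dec_)
open import Relation.Unary using (Decidable)
open import Relation.Binary.PropositionalEquality using (_≡_; _≢_; refl; sym; cong; subst)

suc-≡⇔ : ∀ {i j : ℕ} → (suc i ≡ suc j) ⇔ (i ≡ j)
suc-≡⇔ = mk⇔ suc-injective (cong suc)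

Consecutive : ℕ → ℕ → Set
Consecutive i j = suc i ≡ j ⊎ suc j ≡ i

CyclicSuccessor : ℕ → ℕ → ℕ → Set
CyclicSuccessor L i j = suc i ≡ j ⊎ (suc i ≡ L × j ≡ 0)

CyclicallyAdjacent : ℕ → ℕ → ℕ → Set
CyclicallyAdjacent L i j = CyclicSuccessor L i j ⊎ CyclicSuccessor L j i

suc%≡⇔CyclicSuccessor : ∀ {k i j} → i < suc k → j < suc k →
  (suc i % suc k ≡ j) ⇔ CyclicSuccessor (suc k) i j
suc%≡⇔CyclicSuccessor {k} {i} {j} i<1+k j<1+k with m≤n⇒m<n∨m≡n i<1+k
... | inj₁ 1+i<1+k = mk⇔ (inj₁ ∘ subst (_≡ j) (m<n⇒m%n≡m 1+i<1+k))
  [ subst (_≡ j) (sym (m<n⇒m%n≡m 1+i<1+k)) , (λ (1+i≡1+k , _) → ⊥-elim (<-irrefl 1+i≡1+k 1+i<1+k)) ]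
... | inj₂ 1+i≡1+k = mk⇔ (λ [1+i]%[1+k]≡j → inj₂ (1+i≡1+k , sym (subst (_≡ j) [1+i]%[1+k]≡0 [1+i]%[1+k]≡j)))
  [ (λ 1+i≡j → ⊥-elim (<-irrefl (subst (_≡ suc k) 1+i≡j 1+i≡1+k) j<1+k))
  , (λ (_ , j≡0) → subst (suc i % suc k ≡_) (sym j≡0) [1+i]%[1+k]≡0) ]
  where
    [1+i]%[1+k]≡0 : suc i % suc k ≡ 0
    [1+i]%[1+k]≡0 = subst (λ m → m % suc k ≡ 0) (sym 1+i≡1+k) (n%n≡0 (suc k))

CycAdj⇔CyclicallyAdjacent : ∀ m (i j : Fin (4 + m)) →
  CycAdj m i j ⇔ CyclicallyAdjacent (4 + m) (toℕ i) (toℕ j)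
CycAdj⇔CyclicallyAdjacent m i j =
  suc%≡⇔CyclicSuccessor (toℕ<n i) (toℕ<n j) ⊎-⇔ suc%≡⇔CyclicSuccessor (toℕ<n j) (toℕ<n i)

CyclicSuccessor-suc : ∀ {L i j} → CyclicSuccessor L i (suc j) ⇔ (suc i ≡ suc j)
CyclicSuccessor-suc = mk⇔ [ id , (λ { (_ , ()) }) ] inj₁

CyclicallyAdjacent-suc : ∀ {L i j} → CyclicallyAdjacent L (suc i) (suc j) ⇔ Consecutive i j
CyclicallyAdjacent-suc =
  ⇔.trans (CyclicSuccessor-suc ⊎-⇔ CyclicSuccessor-suc) (suc-≡⇔ ⊎-⇔ suc-≡⇔)

CyclicallyAdjacent-zero : ∀ {L k} → CyclicallyAdjacent (suc (suc L)) 0 (suc k) ⇔ (k ≡ 0 ⊎ suc k ≡ suc L)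
CyclicallyAdjacent-zero = mk⇔ to from
  where
    to : ∀ {L k} → CyclicallyAdjacent (suc (suc L)) 0 (suc k) → k ≡ 0 ⊎ suc k ≡ suc L
    to (inj₁ (inj₁ 1≡1+k)) = inj₁ (sym (suc-injective 1≡1+k))
    to (inj₂ (inj₂ (2+k≡2+L , _))) = inj₂ (suc-injective 2+k≡2+L)
    from : ∀ {L k} → k ≡ 0 ⊎ suc k ≡ suc L → CyclicallyAdjacent (suc (suc L)) 0 (suc k)
    from (inj₁ refl) = inj₁ (inj₁ refl)
    from (inj₂ 1+k≡1+L) = inj₂ (inj₂ (cong suc 1+k≡1+L , refl))

lookup-∷-injective : ∀ {A : Set} {a : A} {p : List A} → Injective _≡_ _≡_ (lookup p) → All (_≢ a) p →
  Injective _≡_ _≡_ (lookup (a ∷ p))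
lookup-∷-injective _ _ {zero} {zero} _ = refl
lookup-∷-injective _ p≢a {zero} {suc j} a≡p[j] = ⊥-elim (All.lookup p≢a (∈-lookup j) (sym a≡p[j]))
lookup-∷-injective _ p≢a {suc i} {zero} p[i]≡a = ⊥-elim (All.lookup p≢a (∈-lookup i) p[i]≡a)
lookup-∷-injective p-injective _ {suc i} {suc j} p[i]≡p[j] = cong suc (p-injective p[i]≡p[j])

module _ {n} (G : Graph n) where

  open import Data.List.Membership.DecPropositional (_≟_ {n}) using () renaming (_∈?_ to _∈ₗ?_)

  Adj? : ∀ u w → Dec (Adj G u w)
  Adj? u w = T? (adj G u w)

  Adj-sym : ∀ {u w} → Adj G u w → Adj G w u
  Adj-sym {u} {w} = subst T (symm G u w)

  Adj-comm : ∀ {u w} → Adj G u w ⇔ Adj G w u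
  Adj-comm = mk⇔ Adj-sym Adj-sym

  -- Induced paths are listed from their first vertex; the index t is the last vertex.
  data InducedPath (t : Fin n) : List (Fin n) → Set where
    single : InducedPath t (t ∷ [])
    extend : ∀ {a b r} → Adj G a b → All (¬_ ∘ Adj G a) r → All (_≢ a) (b ∷ r)
           → InducedPath t (b ∷ r) → InducedPath t (a ∷ b ∷ r)

  end-∈ : ∀ {t p} → InducedPath t p → t ∈ₗ p
  end-∈ single = here refl
  end-∈ (extend _ _ _ P) = there (end-∈ P)

  tail-≢-head : ∀ {t b p} → InducedPath t (b ∷ p) → All (_≢ b) p
  tail-≢-head single = []
  tail-≢-head (extend _ _ p≢b _) = p≢b

  suffix : ∀ {t p u} → InducedPath t p → u ∈ₗ p →
    Σ[ q ∈ List (Fin n) ] InducedPath t (u ∷ q) × u ∷ q ⊆ p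
  suffix single (here refl) = [] , single , id
  suffix P@(extend _ _ _ _) (here refl) = _ , P , id
  suffix (extend _ _ _ P) (there u∈p) with suffix P u∈p
  ... | q , Q , q⊆p = q , Q , there ∘ q⊆p

  last-neighbour : ∀ {t p a} → InducedPath t p → Any (Adj G a) p →
    Σ[ c ∈ Fin n ] Σ[ q ∈ List (Fin n) ]
      InducedPath t (c ∷ q) × Adj G a c × All (¬_ ∘ Adj G a) q × c ∷ q ⊆ p
  last-neighbour single (here a~t) = _ , [] , single , a~t , [] , id
  last-neighbour {a = a} P@(extend {b = b} {r} _ _ _ P′) a~p with any? (Adj? a) (b ∷ r) | a~p
  ... | yes a~tail | _ with last-neighbour P′ a~tail
  ...   | c , q , Q , a~c , a≁q , q⊆p = c , q , Q , a~c , a≁q , there ∘ q⊆p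
  last-neighbour P@(extend _ _ _ _) _ | no a≁tail | here a~c = _ , _ , P , a~c , ¬Any⇒All¬ _ a≁tail , id
  last-neighbour (extend _ _ _ _) _ | no a≁tail | there a~tail = ⊥-elim (a≁tail a~tail)

  record FirstHitPath (W : VSet n) (S : Fin n → Set) (a : Fin n) : Set where
    constructor path
    field
      {end}     : Fin n
      {rest}    : List (Fin n)
      induced   : InducedPath end (a ∷ rest)
      end∈S     : S end
      within    : All W (a ∷ rest)
      first-hit : All (λ u → u ≡ end ⊎ ¬ S u) (a ∷ rest)

  trivial-path : ∀ {W S a} → W a → S a → FirstHitPath W S a
  trivial-path a∈W Sa = path single Sa (a∈W ∷ []) (inj₁ refl ∷ [])

  -- If a already lies on the path we cut the path there; otherwise a jumps to its last neighbour on it.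
  prepend : ∀ {W S a w} → ¬ S a → W a → Adj G a w → FirstHitPath W S w → FirstHitPath W S a
  prepend {a = a} {w} ¬Sa a∈W a~w (path {rest = p} P St p⊆W p-first) with a ∈ₗ? w ∷ p
  ... | yes a∈p with suffix P a∈p
  ...   | q , Q , q⊆p = path Q St (anti-mono q⊆p p⊆W) (anti-mono q⊆p p-first)
  prepend {a = a} {w} ¬Sa a∈W a~w (path {rest = p} P St p⊆W p-first) | no a∉p
    with last-neighbour P (here a~w)
  ... | c , q , Q , a~c , a≁q , q⊆p =
    path (extend a~c a≁q (All.tabulate (λ u∈q u≡a → a∉p (subst (_∈ₗ _) u≡a (q⊆p u∈q)))) Q) St
         (a∈W ∷ anti-mono q⊆p p⊆W) (inj₂ ¬Sa ∷ anti-mono q⊆p p-first)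

  first-hit-path : ∀ {W S} → Decidable S → ∀ {a b} → Connected G W a b → S b → FirstHitPath W S a
  first-hit-path S? (here a∈W) Sa = trivial-path a∈W Sa
  first-hit-path S? {a} (step a∈W a~w w~b) Sb with S? a
  ... | yes Sa = trivial-path a∈W Sa
  ... | no ¬Sa = prepend ¬Sa a∈W a~w (first-hit-path S? w~b Sb)

  lookup-injective : ∀ {t p} → InducedPath t p → Injective _≡_ _≡_ (lookup p)
  lookup-injective single {zero} {zero} _ = refl
  lookup-injective (extend _ _ p≢a P) = lookup-∷-injective (lookup-injective P) p≢a

  lookup≡head⇔ : ∀ {t b p} → InducedPath t (b ∷ p) → ∀ j → lookup (b ∷ p) j ≡ b ⇔ toℕ j ≡ 0
  lookup≡head⇔ P j = mk⇔ (cong toℕ ∘ lookup-injective P {j} {zero})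
                         (λ j≡0 → cong (lookup _) (toℕ-injective j≡0))

  lookup≡end⇔ : ∀ {t p} → InducedPath t p → ∀ j → lookup p j ≡ t ⇔ suc (toℕ j) ≡ length p
  lookup≡end⇔ single zero = mk⇔ (λ _ → refl) (λ _ → refl)
  lookup≡end⇔ (extend _ _ p≢a P) zero =
    mk⇔ (λ a≡t → ⊥-elim (All.lookup p≢a (end-∈ P) (sym a≡t))) (λ ())
  lookup≡end⇔ (extend _ _ _ P) (suc j) = ⇔.trans (lookup≡end⇔ P j) (⇔.sym suc-≡⇔)

  Adj-lookup⇔Consecutive : ∀ {t p} → InducedPath t p → ∀ i j →
    Adj G (lookup p i) (lookup p j) ⇔ Consecutive (toℕ i) (toℕ j)
  Adj-lookup⇔Consecutive single zero zero = mk⇔ (⊥-elim ∘ irrefl G _) λ { (inj₁ ()) ; (inj₂ ()) }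
  Adj-lookup⇔Consecutive (extend _ _ _ _) zero zero = mk⇔ (⊥-elim ∘ irrefl G _) λ { (inj₁ ()) ; (inj₂ ()) }
  Adj-lookup⇔Consecutive (extend a~b _ _ _) zero (suc zero) = mk⇔ (λ _ → inj₁ refl) (λ _ → a~b)
  Adj-lookup⇔Consecutive (extend _ a≁r _ _) zero (suc (suc j)) =
    mk⇔ (⊥-elim ∘ All.lookup a≁r (∈-lookup j)) λ { (inj₁ ()) ; (inj₂ ()) }
  Adj-lookup⇔Consecutive (extend a~b _ _ _) (suc zero) zero = mk⇔ (λ _ → inj₂ refl) (λ _ → Adj-sym a~b)
  Adj-lookup⇔Consecutive (extend _ a≁r _ _) (suc (suc i)) zero =
    mk⇔ (⊥-elim ∘ All.lookup a≁r (∈-lookup i) ∘ Adj-sym) λ { (inj₁ ()) ; (inj₂ ()) }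
  Adj-lookup⇔Consecutive (extend _ _ _ P) (suc i) (suc j) =
    ⇔.trans (Adj-lookup⇔Consecutive P i j) (⇔.sym (suc-≡⇔ ⊎-⇔ suc-≡⇔))

  Adj-apex⇔CyclicallyAdjacent : ∀ {a b p t} → InducedPath t (b ∷ p) →
    All (λ u → Adj G a u ⇔ (u ≡ b ⊎ u ≡ t)) (b ∷ p) → ∀ j →
    Adj G a (lookup (b ∷ p) j) ⇔ CyclicallyAdjacent (length (a ∷ b ∷ p)) 0 (suc (toℕ j))
  Adj-apex⇔CyclicallyAdjacent P a-nbrs j =
    ⇔.trans (All.lookup a-nbrs (∈-lookup j))
      (⇔.trans (lookup≡head⇔ P j ⊎-⇔ lookup≡end⇔ P j) (⇔.sym CyclicallyAdjacent-zero))

  Adj-lookup⇔CyclicallyAdjacent : ∀ {a b p t} → InducedPath t (b ∷ p) →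
    All (λ u → Adj G a u ⇔ (u ≡ b ⊎ u ≡ t)) (b ∷ p) → ∀ i j →
    let c = a ∷ b ∷ p in Adj G (lookup c i) (lookup c j) ⇔ CyclicallyAdjacent (length c) (toℕ i) (toℕ j)
  Adj-lookup⇔CyclicallyAdjacent P a-nbrs zero zero =
    mk⇔ (⊥-elim ∘ irrefl G _) λ { (inj₁ (inj₁ ())) ; (inj₁ (inj₂ (() , _))) ; (inj₂ (inj₁ ())) ; (inj₂ (inj₂ (() , _))) }
  Adj-lookup⇔CyclicallyAdjacent P a-nbrs zero (suc j) = Adj-apex⇔CyclicallyAdjacent P a-nbrs j
  Adj-lookup⇔CyclicallyAdjacent P a-nbrs (suc i) zero =
    ⇔.trans Adj-comm (⇔.trans (Adj-apex⇔CyclicallyAdjacent P a-nbrs i) (mk⇔ swap swap))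
  Adj-lookup⇔CyclicallyAdjacent P a-nbrs (suc i) (suc j) =
    ⇔.trans (Adj-lookup⇔Consecutive P i j) (⇔.sym CyclicallyAdjacent-suc)

  -- The cycle has length at least 4 because the ends of the path are distinct and non-adjacent.
  apex-chordless-cycle : ∀ {W a b p t} → InducedPath t (b ∷ p) → t ≢ b → ¬ Adj G b t
    → All (_≢ a) (b ∷ p) → All (λ u → Adj G a u ⇔ (u ≡ b ⊎ u ≡ t)) (b ∷ p)
    → All W (a ∷ b ∷ p) → ChordlessCycleIn G W
  apex-chordless-cycle single t≢b _ _ _ _ = ⊥-elim (t≢b refl)
  apex-chordless-cycle (extend b~t _ _ single) _ b≁t _ _ _ = ⊥-elim (b≁t b~t)
  apex-chordless-cycle {a = a} {b} {c ∷ d ∷ r} P@(extend _ _ _ (extend _ _ _ _)) _ _ p≢a a-nbrs cycle⊆W =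
    length r , lookup (a ∷ b ∷ c ∷ d ∷ r) , lookup-∷-injective (lookup-injective P) p≢a ,
    All.lookup cycle⊆W ∘ ∈-lookup ,
    λ i j → ⇔.trans (Adj-lookup⇔CyclicallyAdjacent P a-nbrs i j)
                    (⇔.sym (CycAdj⇔CyclicallyAdjacent (length r) i j))

module NonNeighbourOfZ {n} (G : Graph n) {v x z : Fin n} {Bv I : Subset n}
  (v∉Bv : v ∉ Bv) (I-independent : IndependentSet G I) (v~I : ∀ {u} → u ∈ I → Adj G v u)
  (z∈I : z ∈ I) (x∈X : XSet G v Bv I x) (x≁z : ¬ Adj G x z) where

  private
    H = HSet G v Bv I

  H⇒≢v : ∀ {u} → H u → u ≢ v
  H⇒≢v = proj₁

  H⇒∉Bv : ∀ {u} → H u → u ∉ Bv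
  H⇒∉Bv = proj₁ ∘ proj₂

  H⇒≢x : ∀ {u} → H u → u ≢ x
  H⇒≢x (_ , _ , u∉X) u≡x = u∉X (subst (XSet G v Bv I) (sym u≡x) x∈X)

  N[v]∩H⊆I : ∀ {u} → H u → Adj G v u → u ∈ I
  N[v]∩H⊆I {u} (_ , u∉Bv , u∉X) v~u = decidable-stable (u ∈? I) (λ u∉I → u∉X (v~u , u∉Bv , u∉I))

  Stop : Fin n → Set
  Stop u = Adj G x u ⊎ (u ∈ I × u ≢ z)

  Stop? : Decidable Stop
  Stop? u = Adj? G x u ⊎-dec (u ∈? I ×-dec ¬? (u ≟ z))

  module _ (π : FirstHitPath G H Stop z) where
    open FirstHitPath π

    end≢z : end ≢ z
    end≢z end≡z with end∈S
    ... | inj₁ x~end = x≁z (subst (Adj G x) end≡z x~end)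
    ... | inj₂ (_ , end≢z) = end≢z end≡z

    v-neighbour : ∀ {u} → H u → u ≡ end ⊎ ¬ Stop u → Adj G v u → u ≡ z ⊎ u ≡ end
    v-neighbour _ (inj₁ u≡end) _ = inj₂ u≡end
    v-neighbour {u} u∈H (inj₂ ¬Stop) v~u =
      inj₁ (decidable-stable (u ≟ z) (λ u≢z → ¬Stop (inj₂ (N[v]∩H⊆I u∈H v~u , u≢z))))

    x-neighbour : ∀ {u} → u ≡ end ⊎ ¬ Stop u → Adj G x u → u ≡ end
    x-neighbour (inj₁ u≡end) _ = u≡end
    x-neighbour (inj₂ ¬Stop) x~u = ⊥-elim (¬Stop (inj₁ x~u))

    cycle-through-v : end ∈ I → ChordlessCycleIn G (Minus Bv)
    cycle-through-v end∈I =
      apex-chordless-cycle G induced end≢z (I-independent z end z∈I end∈I) (All.map H⇒≢v within)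
        (All.zipWith (λ (u∈H , u-first) → mk⇔ (v-neighbour u∈H u-first) [ v~z , v~end ]) (within , first-hit))
        (v∉Bv ∷ All.map H⇒∉Bv within)
      where
        v~z : ∀ {u} → u ≡ z → Adj G v u
        v~z refl = v~I z∈I
        v~end : ∀ {u} → u ≡ end → Adj G v u
        v~end refl = v~I end∈I

    cycle-through-x : end ∉ I → ChordlessCycleIn G (Minus Bv)
    cycle-through-x end∉I =
      apex-chordless-cycle G (extend (v~I z∈I) v≁rest (All.map H⇒≢v within) induced)
        (H⇒≢v end∈H) v≁end (v≢x ∷ All.map H⇒≢x within)
        (mk⇔ (λ _ → inj₁ refl) (λ _ → Adj-sym G v~x)
          ∷ All.zipWith (λ (u∈H , u-first) → mk⇔ (inj₂ ∘ x-neighbour u-first) [ ⊥-elim ∘ H⇒≢v u∈H , x~end ])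
                        (within , first-hit))
        (proj₁ (proj₂ x∈X) ∷ v∉Bv ∷ All.map H⇒∉Bv within)
      where
        v~x : Adj G v x
        v~x = proj₁ x∈X
        v≢x : v ≢ x
        v≢x v≡x = irrefl G v (subst (Adj G v) (sym v≡x) v~x)
        end∈H : H end
        end∈H = All.lookup within (end-∈ G induced)
        v≁end : ¬ Adj G v end
        v≁end v~end = end∉I (N[v]∩H⊆I end∈H v~end)
        x~end : ∀ {u} → u ≡ end → Adj G x u
        x~end refl with end∈S
        ... | inj₁ x~end = x~end
        ... | inj₂ (end∈I , _) = ⊥-elim (end∉I end∈I)
        v≁rest : All (¬_ ∘ Adj G v) rest
        v≁rest = All.tabulate λ u∈rest v~u →
          [ All.lookup (tail-≢-head G induced) u∈rest , (λ u≡end → v≁end (subst (Adj G v) u≡end v~u)) ]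
          (v-neighbour (All.lookup within (there u∈rest)) (All.lookup first-hit (there u∈rest)) v~u)

    cycle : ChordlessCycleIn G (Minus Bv)
    cycle with end ∈? I
    ... | yes end∈I = cycle-through-v end∈I
    ... | no end∉I = cycle-through-x end∉I

  chordless-cycle : ∀ {y} → Connected G H z y → Adj G x y → ChordlessCycleIn G (Minus Bv)
  chordless-cycle z~y x~y = cycle (first-hit-path G Stop? z~y (inj₁ x~y))

lemma3p8 : ∀ {n} (G : Graph n) (EI EM : Fin n → Fin n → Set)
    → EdgeSubset G EI → EdgeSubset G EM
    → (v : Fin n) (Bv : Subset n) → v ∉ Bv
    → ChordalOn G (Minus Bv)
    → (I : Subset n) → IndependentSet G I
    → (∀ u → u ∈ I → InNR G EI EM v u × u ∉ Bv)
    → (z : Fin n) → z ∈ I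
    → (y : Fin n) → ComponentOf G (HSet G v Bv I) z y
    → (x : Fin n) → XSet G v Bv I x
    → Adj G x y → Adj G x z
lemma3p8 G _ _ _ _ v Bv v∉Bv chordal I I-independent I⊆NR z z∈I y z~y x x∈X x~y with Adj? G x z
... | yes x~z = x~z
... | no x≁z = ⊥-elim (chordal (chordless-cycle z~y x~y))
  where
    open NonNeighbourOfZ G v∉Bv I-independent (λ {u} u∈I → proj₁ (proj₁ (I⊆NR u u∈I))) z∈I x∈X x≁z
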